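{- For any formula $F$, interpretation $^*$ and valuation $e$, $\mathbf{Wn}^{F^*}_e\langle\rangle=\mathbf{Wn}^{\|F\|^*}_e\langle\rangle$, i.e. the winner of the empty run in $e[F^*]$ equals the winner of the empty run in $e[\|F\|^*]$.
   Context: Formulas: first-order formulas over variables, natural-number constants, function and predicate symbols and the logical $=$, built from atoms and $\top,\bot$ with $\neg$ (on atoms only), $\wedge,\vee,\sqcap,\sqcup$ and quantifiers $\forall,\exists,\sqcap x,\sqcup x$. The elementarization $\|F\|$ of $F$ is the result of replacing in $F$ every $\sqcup$- and $\sqcup x$-subformula by $\bot$ and every $\sqcap$- and $\sqcap x$-subformula by $\top$. Games: a constant game has a prefix-closed set of legal runs (sequences of labmoves labeled $\top$ or $\bot$) containing the empty run $\langle\rangle$, and a winner function $\mathbf{Wn}$; a game maps each valuation $e$ (variables $\to\mathbb N$) to a constant game $e[A]$, $\mathbf{Wn}^A_e=\mathbf{Wn}^{e[A]}$. An interpretation $^*$ assigns to each $n$-ary function symbol a function $\mathbb N^n\to\mathbb N$ and to each predicate symbol $p$ an elementary game (no legal moves; a predicate) $p^*(x_1..x_n)$ depending only on $x_1..x_n$, with $=^*$ a congruence; $F^*$ is defined compositionally, the connectives/quantifiers denoting: $\top,\bot$ the elementary games won by $\top$, $\bot$; $\neg$: winner of $\langle\rangle$ swapped (and roles swapped); $A_0\wedge A_1$ / $A_0\vee A_1$: $\langle\rangle$ won by $\top$ iff won by $\top$ in both / at least one of $A_0,A_1$, with moves $i.\beta$ made in component $i$; $A_0\sqcap A_1$: $\langle\rangle$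 won by $\top$, the only initial legal labmoves being $\bot i$ ($i=0,1$), bringing the game to $A_i$; $\sqcup$ dual ($\langle\rangle$ won by $\bot$, labmoves $\top i$); $\sqcap xA(x)=A(0)\sqcap A(1)\sqcap\ldots$ and $\sqcup xA(x)=A(0)\sqcup A(1)\sqcup\ldots$ (infinite versions); $\forall xA(x)$: in instance $e$, $\langle\rangle$ is won by $\top$ iff it is won by $\top$ in $e[A(c)]$ for every constant $c$ (where $e[A(c)]=e'[A]$, $e'$ agreeing with $e$ except $e'(x)=c$), moves being those of $A$; $\exists$ dual. -}

module Defs where

open import Data.Nat using (ℕ; _≟_)
open import Data.Vec using (Vec; []; _∷_)
open import Data.Vec.Relation.Binary.Pointwise.Inductive using (Pointwise)
open import Data.Product using (_×_)
open import Data.Sum using (_⊎_)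
open import Data.Unit using (⊤)
open import Data.Empty using (⊥)
open import Relation.Nullary using (¬_; yes; no)
open import Function.Bundles using (_⇔_)
open import Relation.Binary.Structures using (IsEquivalence)

Var : Set
Var = ℕ

Valuation : Set
Valuation = Var → ℕ

data Term : Set where
  var   : Var → Term
  const : ℕ → Term
  fun   : (f n : ℕ) → Vec Term n → Term

data Atom : Set where
  pred : (p n : ℕ) → Vec Term n → Atom
  _≐_  : Term → Term → Atom

-- Formulas of computability logic (¬ only on atoms).
data Formula : Set where
  atom  : Atom → Formula
  natom : Atom → Formula
  ⊤f ⊥f : Formula
  _∧f_ _∨f_ _⊓f_ _⊔f_ : Formula → Formula → Formula
  ∀f ∃f ⊓x ⊔x : Var → Formula → Formula

elem : Formula → Formula
elem (atom a)  = atom a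
elem (natom a) = natom a
elem ⊤f = ⊤f
elem ⊥f = ⊥f
elem (A ∧f B) = elem A ∧f elem B
elem (A ∨f B) = elem A ∨f elem B
elem (A ⊓f B) = ⊤f
elem (A ⊔f B) = ⊥f
elem (∀f x A) = ∀f x (elem A)
elem (∃f x A) = ∃f x (elem A)
elem (⊓x x A) = ⊤f
elem (⊔x x A) = ⊥f

-- Interpretations: functions for function symbols, elementary games
-- (predicates, given as the proposition "⊤ wins") for predicate symbols,
-- with =* a congruence.
record Interpretation : Set₁ where
  field
    funI  : (f n : ℕ) → Vec ℕ n → ℕ
    predI : (p n : ℕ) → Vec ℕ n → Set
    eqI   : ℕ → ℕ → Set
    eqI-equiv : IsEquivalence eqI
    eqI-cong-fun  : ∀ f n {xs ys : Vec ℕ n} → Pointwise eqI xs ys →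
                    eqI (funI f n xs) (funI f n ys)
    eqI-cong-pred : ∀ p n {xs ys : Vec ℕ n} → Pointwise eqI xs ys →
                    predI p n xs ⇔ predI p n ys
open Interpretation public

_[_≔_] : Valuation → Var → ℕ → Valuation
(e [ x ≔ c ]) y with y ≟ x
... | yes _ = c
... | no  _ = e y

mutual
  evalTerm : Interpretation → Valuation → Term → ℕ
  evalTerm I e (var x) = e x
  evalTerm I e (const c) = c
  evalTerm I e (fun f n ts) = funI I f n (evalTerms I e ts)

  evalTerms : ∀ {n} → Interpretation → Valuation → Vec Term n → Vec ℕ n
  evalTerms I e [] = []
  evalTerms I e (t ∷ ts) = evalTerm I e t ∷ evalTerms I e ts

-- "⊤ wins the elementary game e[a*]"
AtomWn : Interpretation → Valuation → Atom → Set
AtomWn I e (pred p n ts) = predI I p n (evalTerms I e ts)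
AtomWn I e (s ≐ t) = eqI I (evalTerm I e s) (evalTerm I e t)

-- WnEmpty F I e :  Wn^{F*}_e ⟨⟩ = ⊤   (the empty run of e[F*] is won by ⊤),
-- following the compositional definition of the game operations.
WnEmpty : Formula → Interpretation → Valuation → Set
WnEmpty (atom a)  I e = AtomWn I e a
WnEmpty (natom a) I e = ¬ AtomWn I e a
WnEmpty ⊤f I e = ⊤
WnEmpty ⊥f I e = ⊥
WnEmpty (A ∧f B) I e = WnEmpty A I e × WnEmpty B I e
WnEmpty (A ∨f B) I e = WnEmpty A I e ⊎ WnEmpty B I e
WnEmpty (A ⊓f B) I e = ⊤
WnEmpty (A ⊔f B) I e = ⊥
WnEmpty (∀f x A) I e = (c : ℕ) → WnEmpty A I (e [ x ≔ c ])
WnEmpty (∃f x A) I e = Data.Product.Σ ℕ (λ c → WnEmpty A I (e [ x ≔ c ]))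
WnEmpty (⊓x x A) I e = ⊤
WnEmpty (⊔x x A) I e = ⊥

-- At the empty run, a choice game has not yet been played: A ⊓ B and ⊓x A are
-- won by ⊤ and A ⊔ B and ⊔x A by ⊥, exactly like the ⊤ and ⊥ that
-- elementarization puts in their place. The remaining connectives decide the
-- winner of ⟨⟩ compositionally from the winners of their components, so the
-- claim follows by induction on F.
module Submission where

open import Defs
open import Data.Product using (Σ; _,_)
open import Data.Product.Function.NonDependent.Propositional using (_×-⇔_)
open import Data.Sum.Function.Propositional using (_⊎-⇔_)
open import Function.Bundles using (_⇔_; mk⇔; Equivalence)
open import Function.Construct.Identity using (⇔-id)

open Equivalence

Π-cong-⇔ : {A : Set} {B C : A → Set} →
           (∀ a → B a ⇔ C a) → ((a : A) → B a) ⇔ ((a : A) → C a)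
Π-cong-⇔ B⇔C = mk⇔ (λ f a → to (B⇔C a) (f a)) (λ g a → from (B⇔C a) (g a))

Σ-cong-⇔ : {A : Set} {B C : A → Set} →
           (∀ a → B a ⇔ C a) → Σ A B ⇔ Σ A C
Σ-cong-⇔ B⇔C = mk⇔ (λ (a , b) → a , to (B⇔C a) b) (λ (a , c) → a , from (B⇔C a) c)

lemma8p1 : (F : Formula) (I : Interpretation) (e : Valuation) →
           WnEmpty F I e ⇔ WnEmpty (elem F) I e
lemma8p1 (atom a)  I e = ⇔-id _
lemma8p1 (natom a) I e = ⇔-id _
lemma8p1 ⊤f        I e = ⇔-id _
lemma8p1 ⊥f        I e = ⇔-id _
lemma8p1 (A ∧f B)  I e = lemma8p1 A I e ×-⇔ lemma8p1 B I e
lemma8p1 (A ∨f B)  I e = lemma8p1 A I e ⊎-⇔ lemma8p1 B I e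
lemma8p1 (A ⊓f B)  I e = ⇔-id _
lemma8p1 (A ⊔f B)  I e = ⇔-id _
lemma8p1 (∀f x A)  I e = Π-cong-⇔ λ c → lemma8p1 A I (e [ x ≔ c ])
lemma8p1 (∃f x A)  I e = Σ-cong-⇔ λ c → lemma8p1 A I (e [ x ≔ c ])
lemma8p1 (⊓x x A)  I e = ⇔-id _
lemma8p1 (⊔x x A)  I e = ⇔-id _
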